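{- Let $\mathcal{S}_1$ and $\mathcal{S}_2$ be string representations such that $\mathcal{S}_2$ is obtained from $\mathcal{S}_1$ by swapping the elements at positions $i$ and $i+1$ for some $i$, and let $a$ be the element at position $i$ and $b$ the element at position $i+1$ in $\mathcal{S}_1$. Then $\mathcal{S}_1$ and $\mathcal{S}_2$ represent the same interval graph if and only if the two swapped occurrences are either both left endpoints or both right endpoints.
   Context: A string representation is a sequence of length $2n$ in which each $x\in\{1,\dots,n\}$ occurs exactly twice; it represents the interval graph on $\{1,\dots,n\}$ in which $x$ corresponds to the interval $[\mathrm{first}(x),\mathrm{second}(x)]$, where $\mathrm{first}(x),\mathrm{second}(x)$ are the positions of the first and second occurrence of $x$. The first occurrence of $x$ is its left endpoint and the second its right endpoint. -}

module Defs where

open import Data.Nat using (ℕ; suc; _+_; _<_; _≤_)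
open import Data.Fin using (Fin; toℕ; _≟_)
open import Data.List using (List; length; filter; allFin)
open import Data.Product using (_×_; ∃-syntax)
open import Relation.Binary.PropositionalEquality using (_≡_; _≢_)

-- A word of length 2n over the alphabet Fin n (Fin n plays the role of {1,…,n}),
-- positions are Fin (n + n).
Word : ℕ → Set
Word n = Fin (n + n) → Fin n

occ : ∀ {n} → Word n → Fin n → ℕ
occ {n} s x = length (filter (λ p → s p ≟ x) (allFin (n + n)))

IsStringRep : ∀ {n} → Word n → Set
IsStringRep s = ∀ x → occ s x ≡ 2

IsLeftEnd : ∀ {n} → Word n → Fin (n + n) → Set
IsLeftEnd s p = ∀ q → toℕ q < toℕ p → s q ≢ s p

IsRightEnd : ∀ {n} → Word n → Fin (n + n) → Set
IsRightEnd s p = ∃[ q ] (toℕ q < toℕ p × s q ≡ s p)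

IsFirst : ∀ {n} → Word n → Fin n → Fin (n + n) → Set
IsFirst s x p = s p ≡ x × IsLeftEnd s p

IsSecond : ∀ {n} → Word n → Fin n → Fin (n + n) → Set
IsSecond s x p = s p ≡ x × IsRightEnd s p

-- adjacency in the represented interval graph: x ≠ y and the intervals
-- [first x, second x], [first y, second y] intersect
Adj : ∀ {n} → Word n → Fin n → Fin n → Set
Adj s x y = x ≢ y ×
  (∀ fx sx fy sy → IsFirst s x fx → IsSecond s x sx → IsFirst s y fy → IsSecond s y sy →
     toℕ fx ≤ toℕ sy × toℕ fy ≤ toℕ sx)

SwapOf : ∀ {n} → Word n → Word n → Fin (n + n) → Fin (n + n) → Set
SwapOf s₁ s₂ i j = s₂ i ≡ s₁ j × s₂ j ≡ s₁ i × (∀ p → p ≢ i → p ≢ j → s₂ p ≡ s₁ p)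

-- Swapping two adjacent entries that carry different letters keeps, for every letter,
-- the order of its two occurrences; so left endpoints stay left endpoints, right
-- endpoints stay right endpoints, and among all positions only the order of i and i+1
-- is reversed. Adjacency of x and y only compares first(x) with second(y), hence it can
-- change only when one swapped entry is a left and the other a right endpoint. In that
-- case it does change: a left endpoint immediately followed by a right endpoint of
-- another letter makes the two intervals intersect, while after the swap the right
-- endpoint precedes the left one and the intervals are disjoint.
module Submission where

open import Defs
open import Data.Nat using (ℕ; suc; _+_; _≤_; _<_)
open import Data.Nat.Properties
  using (≤-trans; <-trans; <⇒≤; <⇒≱; ≮⇒≥; <-≤-trans; <-irrefl; ≤-reflexive; m<1+n⇒m≤n; _<?_)
open import Data.Fin using (Fin; toℕ; _≟_)
open import Data.Fin.Properties using (<⇒≢; ≤∧≢⇒<; any?)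
open import Data.Fin.Permutation.Components using (transpose)
open import Data.List using (List; []; _∷_; length; filter; allFin)
open import Data.List.Membership.Propositional using (_∈_)
open import Data.List.Membership.Propositional.Properties using (∈-filter⁺; ∈-filter⁻; ∈-allFin)
open import Data.List.Relation.Unary.Any using (here; there)
open import Data.List.Relation.Unary.AllPairs using (_∷_)
open import Data.List.Relation.Unary.All using (_∷_)
open import Data.List.Relation.Unary.Unique.Propositional using (Unique)
import Data.List.Relation.Unary.Unique.Propositional.Properties as Unique
open import Data.Product using (_×_; _,_; proj₁; proj₂; ∃-syntax)
open import Data.Sum using (_⊎_; inj₁; inj₂)
open import Data.Empty using (⊥; ⊥-elim)
open import Relation.Nullary using (¬_; yes; no; contradiction)
open import Relation.Nullary.Decidable using (_×-dec_)
open import Function.Bundles using (_⇔_; mk⇔; Equivalence)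
open import Relation.Binary.PropositionalEquality
  using (_≡_; _≢_; refl; sym; trans; cong; subst; subst₂; ≢-sym)

module _ {a} {A : Set a} where

  unique-length≡2⇒∃≢ : ∀ {x} {xs : List A} → Unique xs → length xs ≡ 2 →
                       x ∈ xs → ∃[ y ] y ∈ xs × y ≢ x
  unique-length≡2⇒∃≢ {xs = _ ∷ _ ∷ []} ((a≢b ∷ _) ∷ _) _ (here refl) =
    _ , there (here refl) , ≢-sym a≢b
  unique-length≡2⇒∃≢ {xs = _ ∷ _ ∷ []} ((a≢b ∷ _) ∷ _) _ (there (here refl)) =
    _ , here refl , a≢b

  length≡2⇒pigeonhole : ∀ {x y z} {xs : List A} → length xs ≡ 2 →
                        x ∈ xs → y ∈ xs → z ∈ xs → x ≡ y ⊎ y ≡ z ⊎ x ≡ z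
  length≡2⇒pigeonhole {xs = _ ∷ _ ∷ []} _ (here refl) (here refl) _ = inj₁ refl
  length≡2⇒pigeonhole {xs = _ ∷ _ ∷ []} _ (there (here refl)) (there (here refl)) _ = inj₁ refl
  length≡2⇒pigeonhole {xs = _ ∷ _ ∷ []} _ (here refl) (there (here refl)) (here refl) =
    inj₂ (inj₂ refl)
  length≡2⇒pigeonhole {xs = _ ∷ _ ∷ []} _ (here refl) (there (here refl)) (there (here refl)) =
    inj₂ (inj₁ refl)
  length≡2⇒pigeonhole {xs = _ ∷ _ ∷ []} _ (there (here refl)) (here refl) (here refl) =
    inj₂ (inj₁ refl)
  length≡2⇒pigeonhole {xs = _ ∷ _ ∷ []} _ (there (here refl)) (here refl) (there (here refl)) =
    inj₂ (inj₂ refl)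

module _ {n : ℕ} (s : Word n) where

  occurrences : Fin n → List (Fin (n + n))
  occurrences x = filter (λ p → s p ≟ x) (allFin (n + n))

  ∈-occurrences⁺ : ∀ {x p} → s p ≡ x → p ∈ occurrences x
  ∈-occurrences⁺ {x} = ∈-filter⁺ (λ p → s p ≟ x) (∈-allFin _)

  ∈-occurrences⁻ : ∀ {x p} → p ∈ occurrences x → s p ≡ x
  ∈-occurrences⁻ {x} p∈ = proj₂ (∈-filter⁻ (λ p → s p ≟ x) {xs = allFin (n + n)} p∈)

  occurrences-unique : ∀ x → Unique (occurrences x)
  occurrences-unique x = Unique.filter⁺ (λ p → s p ≟ x) (Unique.allFin⁺ (n + n))

module _ {n : ℕ} {s : Word n} (rep : IsStringRep s) where

  no-three-occurrences : ∀ {p q r} → toℕ p < toℕ q → toℕ q < toℕ r →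
                         s p ≡ s q → s q ≡ s r → ⊥
  no-three-occurrences {p} {q} {r} p<q q<r sp≡sq sq≡sr
    with length≡2⇒pigeonhole (rep (s q)) (∈-occurrences⁺ s sp≡sq)
                             (∈-occurrences⁺ s refl) (∈-occurrences⁺ s (sym sq≡sr))
  ... | inj₁ p≡q        = <⇒≢ p<q p≡q
  ... | inj₂ (inj₁ q≡r) = <⇒≢ q<r q≡r
  ... | inj₂ (inj₂ p≡r) = <⇒≢ (<-trans p<q q<r) p≡r

  partner : ∀ p → ∃[ q ] q ≢ p × s q ≡ s p
  partner p =
    let q , q∈ , q≢p = unique-length≡2⇒∃≢ (occurrences-unique s (s p)) (rep (s p))
                                          (∈-occurrences⁺ s refl)
    in q , q≢p , ∈-occurrences⁻ s q∈

module _ {n : ℕ} {s : Word n} where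

  isLeftEnd⊎isRightEnd : ∀ p → IsLeftEnd s p ⊎ IsRightEnd s p
  isLeftEnd⊎isRightEnd p with any? (λ q → (toℕ q <? toℕ p) ×-dec (s q ≟ s p))
  ... | yes right = inj₂ right
  ... | no ¬right = inj₁ (λ q q<p sq≡sp → ¬right (q , q<p , sq≡sp))

  leftEnd≢rightEnd : ∀ {p q} → IsLeftEnd s p → IsRightEnd s q → p ≢ q
  leftEnd≢rightEnd left (r , r<p , sr≡sp) refl = left r r<p sr≡sp

  isFirst⇒≤ : ∀ {x f p} → IsFirst s x f → s p ≡ x → toℕ f ≤ toℕ p
  isFirst⇒≤ (sf≡x , left) sp≡x = ≮⇒≥ (λ p<f → left _ p<f (trans sp≡x (sym sf≡x)))

  isSecond⇒≥ : IsStringRep s → ∀ {x t p} → IsSecond s x t → s p ≡ x → toℕ p ≤ toℕ t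
  isSecond⇒≥ rep (st≡x , (q , q<t , sq≡st)) sp≡x =
    ≮⇒≥ (λ t<p → no-three-occurrences rep q<t t<p sq≡st (trans st≡x (sym sp≡x)))

  isRightEnd⇒∃isFirst : IsStringRep s → ∀ {p} → IsRightEnd s p → ∃[ f ] IsFirst s (s p) f
  isRightEnd⇒∃isFirst rep (q , q<p , sq≡sp) =
    q , sq≡sp , λ r r<q sr≡sq → no-three-occurrences rep r<q q<p sr≡sq sq≡sp

  isLeftEnd⇒∃isSecond : IsStringRep s → ∀ {p} → IsLeftEnd s p → ∃[ t ] IsSecond s (s p) t
  isLeftEnd⇒∃isSecond rep {p} left =
    let q , q≢p , sq≡sp = partner rep p
        p<q = ≤∧≢⇒< (≮⇒≥ (λ q<p → left q q<p sq≡sp)) (≢-sym q≢p)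
    in q , sq≡sp , p , p<q , sym sq≡sp

  leftEnd-then-rightEnd⇒Adj : IsStringRep s → ∀ {p q} → toℕ q ≡ suc (toℕ p) →
                              IsLeftEnd s p → IsRightEnd s q → s p ≢ s q → Adj s (s p) (s q)
  leftEnd-then-rightEnd⇒Adj rep {p} {q} q≡1+p left right sp≢sq =
    sp≢sq , λ fx sx fy sy firstˣ secondˣ firstʸ secondʸ →
      let p<q  = ≤-reflexive (sym q≡1+p)
          p≤sx = isSecond⇒≥ rep secondˣ refl
          p<sx = ≤∧≢⇒< p≤sx (leftEnd≢rightEnd left (proj₂ secondˣ))
          fy<q = ≤∧≢⇒< (isFirst⇒≤ firstʸ refl) (leftEnd≢rightEnd (proj₂ firstʸ) right)
          fy≤p = m<1+n⇒m≤n (subst (toℕ fy <_) q≡1+p fy<q)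
      in ≤-trans (isFirst⇒≤ firstˣ refl) (<⇒≤ (<-≤-trans p<q (isSecond⇒≥ rep secondʸ refl)))
       , ≤-trans fy≤p (<⇒≤ p<sx)

  rightEnd-before-leftEnd⇒¬Adj : IsStringRep s → ∀ {p q} → toℕ q < toℕ p →
                                 IsLeftEnd s p → IsRightEnd s q → ¬ Adj s (s p) (s q)
  rightEnd-before-leftEnd⇒¬Adj rep {p} {q} q<p left right (_ , intersect) =
    let t , secondˣ = isLeftEnd⇒∃isSecond rep left
        f , firstʸ  = isRightEnd⇒∃isFirst rep right
    in <⇒≱ q<p (proj₁ (intersect p t f q (refl , left) secondˣ firstʸ (refl , right)))

data TransposeView {m} (i j k : Fin m) : Fin m → Set where
  at-i      : k ≡ i → TransposeView i j k j
  at-j      : k ≢ i → k ≡ j → TransposeView i j k i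
  elsewhere : k ≢ i → k ≢ j → TransposeView i j k k

transpose-view : ∀ {m} (i j k : Fin m) → TransposeView i j k (transpose i j k)
transpose-view i j k with k ≟ i
... | yes k≡i = at-i k≡i
... | no k≢i with k ≟ j
...   | yes k≡j = at-j k≢i k≡j
...   | no k≢j  = elsewhere k≢i k≢j

module _ {m} (i j : Fin m) where

  transpose-matchˡ : transpose i j i ≡ j
  transpose-matchˡ with transpose i j i | transpose-view i j i
  ... | _ | at-i _          = refl
  ... | _ | at-j i≢i _      = contradiction refl i≢i
  ... | _ | elsewhere i≢i _ = contradiction refl i≢i

  transpose-matchʳ : transpose i j j ≡ i
  transpose-matchʳ with transpose i j j | transpose-view i j j
  ... | _ | at-i j≡i        = j≡i
  ... | _ | at-j _ _        = refl
  ... | _ | elsewhere _ j≢j = contradiction refl j≢j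

  transpose-involutive : ∀ k → transpose i j (transpose i j k) ≡ k
  transpose-involutive k with transpose i j k | transpose-view i j k
  ... | _ | at-i refl   = transpose-matchʳ
  ... | _ | at-j _ refl = transpose-matchˡ
  ... | _ | elsewhere k≢i k≢j with transpose i j k | transpose-view i j k
  ...   | _ | at-i k≡i      = contradiction k≡i k≢i
  ...   | _ | at-j _ k≡j    = contradiction k≡j k≢j
  ...   | _ | elsewhere _ _ = refl

module _ {m} {i j : Fin m} where

  transpose-mono-< : toℕ j ≡ suc (toℕ i) → ∀ {q p} → toℕ q < toℕ p → ¬ (q ≡ i × p ≡ j) →
                     toℕ (transpose i j q) < toℕ (transpose i j p)
  transpose-mono-< j≡1+i {q} {p} q<p ¬ij
    with transpose i j q | transpose-view i j q | transpose i j p | transpose-view i j p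
  ... | _ | at-i refl   | _ | at-i refl   = contradiction q<p (<-irrefl refl)
  ... | _ | at-i refl   | _ | at-j _ refl = contradiction (refl , refl) ¬ij
  ... | _ | at-i refl   | _ | elsewhere _ p≢j =
    ≤∧≢⇒< (subst (_≤ toℕ p) (sym j≡1+i) q<p) (≢-sym p≢j)
  ... | _ | at-j _ refl | _ | at-i refl   =
    contradiction (<-trans q<p (≤-reflexive (sym j≡1+i))) (<-irrefl refl)
  ... | _ | at-j _ refl | _ | at-j _ refl = contradiction q<p (<-irrefl refl)
  ... | _ | at-j _ refl | _ | elsewhere _ _ = <-trans (≤-reflexive (sym j≡1+i)) q<p
  ... | _ | elsewhere _ _   | _ | at-i refl   = <-trans q<p (≤-reflexive (sym j≡1+i))
  ... | _ | elsewhere q≢i _ | _ | at-j _ refl =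
    ≤∧≢⇒< (m<1+n⇒m≤n (subst (toℕ q <_) j≡1+i q<p)) q≢i
  ... | _ | elsewhere _ _   | _ | elsewhere _ _ = q<p

module _ {n} {s₁ s₂ : Word n} {i j : Fin (n + n)} (swap : SwapOf s₁ s₂ i j) where

  swapOf-sym : SwapOf s₂ s₁ i j
  swapOf-sym = let s₂i≡s₁j , s₂j≡s₁i , rest = swap
               in sym s₂j≡s₁i , sym s₂i≡s₁j , λ p p≢i p≢j → sym (rest p p≢i p≢j)

  swapOf-≢ : s₁ i ≢ s₁ j → s₂ i ≢ s₂ j
  swapOf-≢ s₁i≢s₁j s₂i≡s₂j =
    let s₂i≡s₁j , s₂j≡s₁i , _ = swap
    in s₁i≢s₁j (trans (sym s₂j≡s₁i) (trans (sym s₂i≡s₂j) s₂i≡s₁j))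

  swapOf⇒≗transpose : ∀ p → s₂ p ≡ s₁ (transpose i j p)
  swapOf⇒≗transpose p with transpose i j p | transpose-view i j p
  ... | _ | at-i refl         = proj₁ swap
  ... | _ | at-j _ refl       = proj₁ (proj₂ swap)
  ... | _ | elsewhere p≢i p≢j = proj₂ (proj₂ swap) p p≢i p≢j

module SwapTransport {n} {s₁ s₂ : Word n} {i j : Fin (n + n)} (j≡1+i : toℕ j ≡ suc (toℕ i))
                     (swap : SwapOf s₁ s₂ i j) (s₁i≢s₁j : s₁ i ≢ s₁ j) where

  private
    σ : Fin (n + n) → Fin (n + n)
    σ = transpose i j

    s₂∘σ≗s₁ : ∀ p → s₂ (σ p) ≡ s₁ p
    s₂∘σ≗s₁ p = trans (swapOf⇒≗transpose swap (σ p)) (cong s₁ (transpose-involutive i j p))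

    σ-mono-on : ∀ (t : Word n) → t i ≢ t j → ∀ {q p} → toℕ q < toℕ p → t q ≡ t p →
                toℕ (σ q) < toℕ (σ p)
    σ-mono-on t ti≢tj q<p tq≡tp = transpose-mono-< j≡1+i q<p λ { (refl , refl) → ti≢tj tq≡tp }

  isLeftEnd-transpose : ∀ {p} → IsLeftEnd s₁ p → IsLeftEnd s₂ (transpose i j p)
  isLeftEnd-transpose {p} left q q<σp s₂q≡s₂σp =
    left (σ q) (subst (toℕ (σ q) <_) (cong toℕ (transpose-involutive i j p))
                      (σ-mono-on s₂ (swapOf-≢ swap s₁i≢s₁j) q<σp s₂q≡s₂σp))
         (trans (sym (swapOf⇒≗transpose swap q)) (trans s₂q≡s₂σp (s₂∘σ≗s₁ p)))

  isRightEnd-transpose : ∀ {p} → IsRightEnd s₁ p → IsRightEnd s₂ (transpose i j p)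
  isRightEnd-transpose {p} (q , q<p , s₁q≡s₁p) =
    σ q , σ-mono-on s₁ s₁i≢s₁j q<p s₁q≡s₁p
        , trans (s₂∘σ≗s₁ q) (trans s₁q≡s₁p (sym (s₂∘σ≗s₁ p)))

  isFirst-transpose : ∀ {x p} → IsFirst s₁ x p → IsFirst s₂ x (transpose i j p)
  isFirst-transpose {p = p} (s₁p≡x , left) = trans (s₂∘σ≗s₁ p) s₁p≡x , isLeftEnd-transpose left

  isSecond-transpose : ∀ {x p} → IsSecond s₁ x p → IsSecond s₂ x (transpose i j p)
  isSecond-transpose {p = p} (s₁p≡x , right) = trans (s₂∘σ≗s₁ p) s₁p≡x , isRightEnd-transpose right

  isLeftEnd-swapᵢ : IsLeftEnd s₁ i → IsLeftEnd s₂ j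
  isLeftEnd-swapᵢ left = subst (IsLeftEnd s₂) (transpose-matchˡ i j) (isLeftEnd-transpose left)

  isLeftEnd-swapⱼ : IsLeftEnd s₁ j → IsLeftEnd s₂ i
  isLeftEnd-swapⱼ left = subst (IsLeftEnd s₂) (transpose-matchʳ i j) (isLeftEnd-transpose left)

  isRightEnd-swapᵢ : IsRightEnd s₁ i → IsRightEnd s₂ j
  isRightEnd-swapᵢ right = subst (IsRightEnd s₂) (transpose-matchˡ i j) (isRightEnd-transpose right)

  isRightEnd-swapⱼ : IsRightEnd s₁ j → IsRightEnd s₂ i
  isRightEnd-swapⱼ right = subst (IsRightEnd s₂) (transpose-matchʳ i j) (isRightEnd-transpose right)

module SwapAdjacency {n} {s₁ s₂ : Word n} {i j : Fin (n + n)} (j≡1+i : toℕ j ≡ suc (toℕ i))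
                     (swap : SwapOf s₁ s₂ i j) (s₁i≢s₁j : s₁ i ≢ s₁ j) where

  private
    module Forward  = SwapTransport j≡1+i swap s₁i≢s₁j
    module Backward = SwapTransport j≡1+i (swapOf-sym swap) (swapOf-≢ swap s₁i≢s₁j)

  Adj-transpose : ¬ (IsLeftEnd s₁ i × IsRightEnd s₁ j) → ∀ {x y} → Adj s₁ x y → Adj s₂ x y
  Adj-transpose ¬crossing (x≢y , intersect₁) = x≢y , intersect₂
    where
      reflect-≤ : ∀ {f t} → IsLeftEnd s₂ f → IsRightEnd s₂ t →
                  toℕ (transpose i j f) ≤ toℕ (transpose i j t) → toℕ f ≤ toℕ t
      reflect-≤ {f} {t} left right σf≤σt =
        ≮⇒≥ λ t<f → <⇒≱ (transpose-mono-< j≡1+i t<f not-ij) σf≤σt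
        where
          not-ij : ¬ (t ≡ i × f ≡ j)
          not-ij (refl , refl) =
            ¬crossing (Backward.isLeftEnd-swapⱼ left , Backward.isRightEnd-swapᵢ right)

      intersect₂ : ∀ fx sx fy sy → IsFirst s₂ _ fx → IsSecond s₂ _ sx →
                   IsFirst s₂ _ fy → IsSecond s₂ _ sy → toℕ fx ≤ toℕ sy × toℕ fy ≤ toℕ sx
      intersect₂ fx sx fy sy firstˣ secondˣ firstʸ secondʸ =
        let fx≤sy , fy≤sx = intersect₁ _ _ _ _
              (Backward.isFirst-transpose firstˣ) (Backward.isSecond-transpose secondˣ)
              (Backward.isFirst-transpose firstʸ) (Backward.isSecond-transpose secondʸ)
        in reflect-≤ (proj₂ firstˣ) (proj₂ secondʸ) fx≤sy
         , reflect-≤ (proj₂ firstʸ) (proj₂ secondˣ) fy≤sx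

  crossing-breaks-Adj : IsStringRep s₁ → IsStringRep s₂ → IsLeftEnd s₁ i → IsRightEnd s₁ j →
                        Adj s₁ (s₁ i) (s₁ j) × ¬ Adj s₂ (s₁ i) (s₁ j)
  crossing-breaks-Adj rep₁ rep₂ left right =
    leftEnd-then-rightEnd⇒Adj rep₁ j≡1+i left right s₁i≢s₁j ,
    subst₂ (λ x y → ¬ Adj s₂ x y) (proj₁ (proj₂ swap)) (proj₁ swap)
      (rightEnd-before-leftEnd⇒¬Adj rep₂ (≤-reflexive (sym j≡1+i))
        (Forward.isLeftEnd-swapᵢ left) (Forward.isRightEnd-swapⱼ right))

SameGraph : ∀ {n} → Word n → Word n → Set
SameGraph s₁ s₂ = ∀ x y → Adj s₁ x y ⇔ Adj s₂ x y

SameEndKind : ∀ {n} → Word n → Fin (n + n) → Fin (n + n) → Set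
SameEndKind s i j = (IsLeftEnd s i × IsLeftEnd s j) ⊎ (IsRightEnd s i × IsRightEnd s j)

module _ {n} {s₁ s₂ : Word n} {i j : Fin (n + n)} (j≡1+i : toℕ j ≡ suc (toℕ i))
         (swap : SwapOf s₁ s₂ i j) (s₁i≢s₁j : s₁ i ≢ s₁ j) where

  private
    s₂i≢s₂j : s₂ i ≢ s₂ j
    s₂i≢s₂j = swapOf-≢ swap s₁i≢s₁j

    module Forward  = SwapTransport j≡1+i swap s₁i≢s₁j
    module Backward = SwapTransport j≡1+i (swapOf-sym swap) s₂i≢s₂j
    module Adj₁₂    = SwapAdjacency j≡1+i swap s₁i≢s₁j
    module Adj₂₁    = SwapAdjacency j≡1+i (swapOf-sym swap) s₂i≢s₂j

  sameEndKind⇒sameGraph : SameEndKind s₁ i j → SameGraph s₁ s₂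
  sameEndKind⇒sameGraph (inj₁ (leftᵢ , leftⱼ)) _ _ = mk⇔
    (Adj₁₂.Adj-transpose λ (_ , rightⱼ) → leftEnd≢rightEnd leftⱼ rightⱼ refl)
    (Adj₂₁.Adj-transpose λ (_ , rightⱼ) →
       leftEnd≢rightEnd leftᵢ (Backward.isRightEnd-swapⱼ rightⱼ) refl)
  sameEndKind⇒sameGraph (inj₂ (rightᵢ , rightⱼ)) _ _ = mk⇔
    (Adj₁₂.Adj-transpose λ (leftᵢ , _) → leftEnd≢rightEnd leftᵢ rightᵢ refl)
    (Adj₂₁.Adj-transpose λ (leftᵢ , _) →
       leftEnd≢rightEnd (Backward.isLeftEnd-swapᵢ leftᵢ) rightⱼ refl)

  sameGraph⇒sameEndKind : IsStringRep s₁ → IsStringRep s₂ → SameGraph s₁ s₂ → SameEndKind s₁ i j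
  sameGraph⇒sameEndKind rep₁ rep₂ same with isLeftEnd⊎isRightEnd i | isLeftEnd⊎isRightEnd j
  ... | inj₁ leftᵢ  | inj₁ leftⱼ  = inj₁ (leftᵢ , leftⱼ)
  ... | inj₂ rightᵢ | inj₂ rightⱼ = inj₂ (rightᵢ , rightⱼ)
  ... | inj₁ leftᵢ  | inj₂ rightⱼ =
    let adj₁ , ¬adj₂ = Adj₁₂.crossing-breaks-Adj rep₁ rep₂ leftᵢ rightⱼ
    in ⊥-elim (¬adj₂ (Equivalence.to (same _ _) adj₁))
  ... | inj₂ rightᵢ | inj₁ leftⱼ  =
    let adj₂ , ¬adj₁ = Adj₂₁.crossing-breaks-Adj rep₂ rep₁
                         (Forward.isLeftEnd-swapⱼ leftⱼ) (Forward.isRightEnd-swapᵢ rightᵢ)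
    in ⊥-elim (¬adj₁ (Equivalence.from (same _ _) adj₂))

lemma7 : (n : ℕ) (s₁ s₂ : Word n) → IsStringRep s₁ → IsStringRep s₂ →
    (i j : Fin (n + n)) → toℕ j ≡ suc (toℕ i) → SwapOf s₁ s₂ i j →
    s₁ i ≢ s₁ j →
    ((∀ x y → Adj s₁ x y ⇔ Adj s₂ x y) ⇔
     ((IsLeftEnd s₁ i × IsLeftEnd s₁ j) ⊎ (IsRightEnd s₁ i × IsRightEnd s₁ j)))
lemma7 _ _ _ rep₁ rep₂ _ _ j≡1+i swap s₁i≢s₁j = mk⇔
  (sameGraph⇒sameEndKind j≡1+i swap s₁i≢s₁j rep₁ rep₂)
  (sameEndKind⇒sameGraph j≡1+i swap s₁i≢s₁j)
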